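{- Let $\mathbf b=(b_1,b_2)\in\mathbb N^2$ with $\gcd(b_1,b_2)=1$, and let $\mathcal W\subset\mathbb Z^2$ be a finite set of lattice points such that any two distinct points of $\mathcal W$ are $\mathbf b$-visible from each other. Then $|\mathcal W|\le 2^{b_1+b_2}$.
   Context: $\mathbf b$-visibility: given two distinct lattice points $P=(p_1,p_2)$ and $Q=(q_1,q_2)$, they determine a curve through both of the form $a_1(y-q_2)^{b_1}=a_2(x-q_1)^{b_2}$ for some $(a_1,a_2)\in\mathbb Q^2\setminus\{(0,0)\}$; $P$ is $\mathbf b$-visible from $Q$ if no other lattice point lies on the segment of this curve between $P$ and $Q$. -}

module Defs where

open import Data.Nat using (ℕ; zero; suc)
open import Data.Integer as ℤ using (ℤ)
open import Data.Rational as ℚ using (ℚ; _/_; 0ℚ; 1ℚ; _*_)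
open import Data.Product using (_×_; Σ; _,_)
open import Data.Sum using (_⊎_)
open import Relation.Binary.PropositionalEquality using (_≡_; _≢_)
open import Relation.Nullary using (¬_)

Point : Set
Point = ℤ × ℤ

toℚ : ℤ → ℚ
toℚ z = z / 1

_^ℚ_ : ℚ → ℕ → ℚ
q ^ℚ zero  = 1ℚ
q ^ℚ suc n = q * (q ^ℚ n)

OnCurve : (b₁ b₂ : ℕ) (a₁ a₂ : ℚ) (Q R : Point) → Set
OnCurve b₁ b₂ a₁ a₂ (q₁ , q₂) (r₁ , r₂) =
  a₁ * (toℚ (r₂ ℤ.- q₂) ^ℚ b₁) ≡ a₂ * (toℚ (r₁ ℤ.- q₁) ^ℚ b₂)

Between : ℤ → ℤ → ℤ → Set
Between u v z = (u ℤ.≤ z × z ℤ.≤ v) ⊎ (v ℤ.≤ z × z ℤ.≤ u)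

-- R lies in the closed axis-parallel box spanned by P and Q; the part of the
-- (monotone-branched) curve through Q and P inside this box is exactly the arc
-- of the curve between P and Q.
InBox : (P Q R : Point) → Set
InBox (p₁ , p₂) (q₁ , q₂) (r₁ , r₂) = Between q₁ p₁ r₁ × Between q₂ p₂ r₂

Visible : (b₁ b₂ : ℕ) (P Q : Point) → Set
Visible b₁ b₂ P Q =
  Σ ℚ λ a₁ → Σ ℚ λ a₂ →
    ¬ (a₁ ≡ 0ℚ × a₂ ≡ 0ℚ)
    × OnCurve b₁ b₂ a₁ a₂ Q P
    × OnCurve b₁ b₂ a₁ a₂ Q Q
    × ((R : Point) → OnCurve b₁ b₂ a₁ a₂ Q R → InBox P Q R → R ≡ P ⊎ R ≡ Q)

module Submission where

-- Sort the points into the 2 ^ (b₁ + b₂) classes of ℤ² modulo (2 ^ b₁ , 2 ^ b₂).  If distinct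
-- P = Q + (2 ^ b₁ k₁ , 2 ^ b₂ k₂) shared a class, then R = Q + (k₁ , k₂) would lie on the same
-- curve through Q, since the curve a₁ y ^ b₁ = a₂ x ^ b₂ is invariant under the dilation
-- (x , y) ↦ (2 ^ b₁ x , 2 ^ b₂ y), and inside the box spanned by P and Q.  R ≠ Q as k ≠ 0, and
-- R = P would make k a fixed point of the dilation, which forces k = 0 (when b₁ = 0 the curve
-- through Q is the vertical line x = q₁ instead).  So visibility forbids shared classes.  The
-- coprimality of b₁ and b₂ is only needed to rule out b₁ = b₂ = 0.

open import Defs
open import Algebra.Bundles using (CommutativeRing)
open import Data.Fin as Fin using (Fin; combine; fromℕ<)
open import Data.Fin.Properties using (combine-injectiveˡ; combine-injectiveʳ; fromℕ<-injective; injective⇒≤)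
open import Data.Integer as ℤ using (ℤ; +_; 0ℤ; 1ℤ)
open import Data.Integer.DivMod using (_%ℕ_; _/ℕ_; n%ℕd<d; a≡a%ℕn+[a/ℕn]*n)
import Data.Integer.Properties as ℤP
open import Data.Integer.Tactic.RingSolver using (solve-∀)
open import Data.List using (List; length; lookup)
open import Data.List.Membership.Propositional using (_∈_)
open import Data.List.Membership.Propositional.Properties using (∈-lookup)
import Data.List.Relation.Unary.All as All
open import Data.List.Relation.Unary.AllPairs using (_∷_)
open import Data.List.Relation.Unary.Unique.Propositional using (Unique)
open import Data.Nat as ℕ using (ℕ; zero; suc; _+_; _^_; _≤_; NonZero)
open import Data.Nat.Coprimality using (1-coprimeTo) renaming (sym to coprime-sym)
open import Data.Nat.GCD using (gcd)
import Data.Nat.Properties as ℕP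
open import Data.Product using (_×_; _,_; proj₁; proj₂; ∃-syntax; ∃₂; swap)
open import Data.Product.Properties using (≡-dec)
open import Data.Rational as ℚ using (ℚ; mkℚ; 0ℚ; 1ℚ; _*_; 1/_; ↥_)
import Data.Rational.Properties as ℚP
open import Data.Sum using (_⊎_; inj₁; inj₂; [_,_])
open import Function using (_∘_; id)
open import Function.Bundles using (_⇔_; mk⇔; Equivalence)
open import Function.Definitions using (Injective)
open import Relation.Nullary using (¬_; yes; no; contradiction)
open import Relation.Binary.PropositionalEquality using (_≡_; _≢_; refl; sym; trans; cong; cong₂; subst; subst₂; module ≡-Reasoning)
import Algebra.Properties.CommutativeSemiring.Exp
  (CommutativeRing.commutativeSemiring ℚP.+-*-commutativeRing) as ℚExp
open import Algebra.Properties.AbelianGroup ℤP.+-0-abelianGroup using (∙-cancelˡ)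

^ℚ≗^ : ∀ x n → x ^ℚ n ≡ x ℚExp.^ n
^ℚ≗^ x zero    = refl
^ℚ≗^ x (suc n) = cong (x *_) (^ℚ≗^ x n)

^ℚ-distribʳ-* : ∀ x y n → (x * y) ^ℚ n ≡ x ^ℚ n * y ^ℚ n
^ℚ-distribʳ-* x y n = begin
  (x * y) ^ℚ n           ≡⟨ ^ℚ≗^ (x * y) n ⟩
  (x * y) ℚExp.^ n       ≡⟨ ℚExp.^-distrib-* x y n ⟩
  x ℚExp.^ n * y ℚExp.^ n ≡⟨ sym (cong₂ _*_ (^ℚ≗^ x n) (^ℚ≗^ y n)) ⟩
  x ^ℚ n * y ^ℚ n        ∎
  where open ≡-Reasoning

^ℚ-*-assoc : ∀ x m n → (x ^ℚ m) ^ℚ n ≡ x ^ℚ (m ℕ.* n)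
^ℚ-*-assoc x m n = begin
  (x ^ℚ m) ^ℚ n         ≡⟨ ^ℚ≗^ (x ^ℚ m) n ⟩
  (x ^ℚ m) ℚExp.^ n     ≡⟨ cong (ℚExp._^ n) (^ℚ≗^ x m) ⟩
  (x ℚExp.^ m) ℚExp.^ n ≡⟨ ℚExp.^-assocʳ x m n ⟩
  x ℚExp.^ (m ℕ.* n)    ≡⟨ sym (^ℚ≗^ x (m ℕ.* n)) ⟩
  x ^ℚ (m ℕ.* n)        ∎
  where open ≡-Reasoning

^ℚ-comm : ∀ x m n → (x ^ℚ m) ^ℚ n ≡ (x ^ℚ n) ^ℚ m
^ℚ-comm x m n = begin
  (x ^ℚ m) ^ℚ n  ≡⟨ ^ℚ-*-assoc x m n ⟩
  x ^ℚ (m ℕ.* n) ≡⟨ cong (x ^ℚ_) (ℕP.*-comm m n) ⟩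
  x ^ℚ (n ℕ.* m) ≡⟨ sym (^ℚ-*-assoc x n m) ⟩
  (x ^ℚ n) ^ℚ m  ∎
  where open ≡-Reasoning

*-cancelʳ-≡ : ∀ {p q} r → r ≢ 0ℚ → p * r ≡ q * r → p ≡ q
*-cancelʳ-≡ {p} {q} r r≢0 eq = begin
  p               ≡⟨ sym (ℚP.*-identityʳ p) ⟩
  p * 1ℚ          ≡⟨ cong (p *_) (sym (ℚP.*-inverseʳ r)) ⟩
  p * (r * 1/ r)  ≡⟨ sym (ℚP.*-assoc p r (1/ r)) ⟩
  (p * r) * 1/ r  ≡⟨ cong (_* 1/ r) eq ⟩
  (q * r) * 1/ r  ≡⟨ ℚP.*-assoc q r (1/ r) ⟩
  q * (r * 1/ r)  ≡⟨ cong (q *_) (ℚP.*-inverseʳ r) ⟩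
  q * 1ℚ          ≡⟨ ℚP.*-identityʳ q ⟩
  q               ∎
  where open ≡-Reasoning
        instance _ = ℚ.≢-nonZero r≢0

*≡0⇒≡0⊎≡0 : ∀ p q → p * q ≡ 0ℚ → p ≡ 0ℚ ⊎ q ≡ 0ℚ
*≡0⇒≡0⊎≡0 p q eq with p ℚ.≟ 0ℚ
... | yes p≡0 = inj₁ p≡0
... | no  p≢0 = inj₂ (*-cancelʳ-≡ p p≢0 (trans (ℚP.*-comm q p) (trans eq (sym (ℚP.*-zeroˡ p)))))

^ℚ≡0⇒≡0 : ∀ x n → x ^ℚ n ≡ 0ℚ → x ≡ 0ℚ
^ℚ≡0⇒≡0 x zero    ()
^ℚ≡0⇒≡0 x (suc n) eq = [ id , ^ℚ≡0⇒≡0 x n ] (*≡0⇒≡0⊎≡0 x (x ^ℚ n) eq)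

toℚ≡mkℚ : ∀ i → toℚ i ≡ mkℚ i 0 (coprime-sym (1-coprimeTo _))
toℚ≡mkℚ i = ℚP.↥p/↧p≡p (mkℚ i 0 (coprime-sym (1-coprimeTo _)))

toℚ-injective : ∀ {i j} → toℚ i ≡ toℚ j → i ≡ j
toℚ-injective {i} {j} eq = cong ↥_ (trans (sym (toℚ≡mkℚ i)) (trans eq (toℚ≡mkℚ j)))

toℚ-* : ∀ i j → toℚ (i ℤ.* j) ≡ toℚ i * toℚ j
toℚ-* i j = sym (cong₂ _*_ (toℚ≡mkℚ i) (toℚ≡mkℚ j))

toℚ-^ : ∀ m n → toℚ (+ (m ^ n)) ≡ toℚ (+ m) ^ℚ n
toℚ-^ m zero    = refl
toℚ-^ m (suc n) = begin
  toℚ (+ (m ℕ.* m ^ n))      ≡⟨ cong toℚ (ℤP.pos-* m (m ^ n)) ⟩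
  toℚ (+ m ℤ.* + (m ^ n))    ≡⟨ toℚ-* (+ m) (+ (m ^ n)) ⟩
  toℚ (+ m) * toℚ (+ (m ^ n)) ≡⟨ cong (toℚ (+ m) *_) (toℚ-^ m n) ⟩
  toℚ (+ m) ^ℚ suc n         ∎
  where open ≡-Reasoning

[i+j]-i≡j : ∀ i j → (i ℤ.+ j) ℤ.- i ≡ j
[i+j]-i≡j = solve-∀

module Curve (b₁ b₂ : ℕ) (a₁ a₂ : ℚ) where

  OnCurve₀ : ℚ → ℚ → Set
  OnCurve₀ x y = a₁ * y ^ℚ b₁ ≡ a₂ * x ^ℚ b₂

  OnCurve⇔OnCurve₀ : ∀ q₁ q₂ d₁ d₂ →
    OnCurve b₁ b₂ a₁ a₂ (q₁ , q₂) (q₁ ℤ.+ d₁ , q₂ ℤ.+ d₂) ⇔ OnCurve₀ (toℚ d₁) (toℚ d₂)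
  OnCurve⇔OnCurve₀ q₁ q₂ d₁ d₂ rewrite [i+j]-i≡j q₁ d₁ | [i+j]-i≡j q₂ d₂ = mk⇔ id id

  OnCurve⇒OnCurve₀-origin : ∀ q₁ q₂ → OnCurve b₁ b₂ a₁ a₂ (q₁ , q₂) (q₁ , q₂) → OnCurve₀ 0ℚ 0ℚ
  OnCurve⇒OnCurve₀-origin q₁ q₂ rewrite ℤP.+-inverseʳ q₁ | ℤP.+-inverseʳ q₂ = id

  -- Both sides of the equation pick up the same factor c ^ (b₁ b₂).
  OnCurve₀-dilate⁻¹ : ∀ {x y} c → c ≢ 0ℚ → OnCurve₀ (x * c ^ℚ b₁) (y * c ^ℚ b₂) → OnCurve₀ x y
  OnCurve₀-dilate⁻¹ {x} {y} c c≢0 on = *-cancelʳ-≡ M M≢0 (begin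
    a₁ * y ^ℚ b₁ * M                ≡⟨ ℚP.*-assoc a₁ (y ^ℚ b₁) M ⟩
    a₁ * (y ^ℚ b₁ * M)              ≡⟨ cong (a₁ *_) (sym (^ℚ-distribʳ-* y (c ^ℚ b₂) b₁)) ⟩
    a₁ * (y * c ^ℚ b₂) ^ℚ b₁         ≡⟨ on ⟩
    a₂ * (x * c ^ℚ b₁) ^ℚ b₂         ≡⟨ cong (a₂ *_) (^ℚ-distribʳ-* x (c ^ℚ b₁) b₂) ⟩
    a₂ * (x ^ℚ b₂ * (c ^ℚ b₁) ^ℚ b₂) ≡⟨ cong (λ t → a₂ * (x ^ℚ b₂ * t)) (^ℚ-comm c b₁ b₂) ⟩
    a₂ * (x ^ℚ b₂ * M)              ≡⟨ sym (ℚP.*-assoc a₂ (x ^ℚ b₂) M) ⟩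
    a₂ * x ^ℚ b₂ * M                ∎)
    where
    open ≡-Reasoning
    M : ℚ
    M = (c ^ℚ b₂) ^ℚ b₁
    M≢0 : M ≢ 0ℚ
    M≢0 = c≢0 ∘ ^ℚ≡0⇒≡0 c b₂ ∘ ^ℚ≡0⇒≡0 (c ^ℚ b₂) b₁

open Curve using (OnCurve₀)

-- For b₁ = 0 the equation a₁ = a₂ x ^ b₂ does not involve y; through the origin it forces a₁ = 0.
OnCurve₀-axis : ∀ b {a₁ a₂} x y → ¬ (a₁ ≡ 0ℚ × a₂ ≡ 0ℚ) →
  OnCurve₀ 0 (suc b) a₁ a₂ 0ℚ 0ℚ → OnCurve₀ 0 (suc b) a₁ a₂ x y → x ≡ 0ℚ
OnCurve₀-axis b {a₁} {a₂} x y a≢0 origin on =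
  [ (λ a₂≡0 → contradiction (a₁≡0 , a₂≡0) a≢0) , ^ℚ≡0⇒≡0 x (suc b) ]
    (*≡0⇒≡0⊎≡0 a₂ (x ^ℚ suc b) (trans (sym on) (trans (ℚP.*-identityʳ a₁) a₁≡0)))
  where
  a₁≡0 : a₁ ≡ 0ℚ
  a₁≡0 = trans (sym (ℚP.*-identityʳ a₁))
           (trans origin (trans (cong (a₂ *_) (ℚP.*-zeroˡ (0ℚ ^ℚ b))) (ℚP.*-zeroʳ a₂)))

between-+-* : ∀ q k N → 1 ≤ N → Between q (q ℤ.+ k ℤ.* + N) (q ℤ.+ k)
between-+-* q k@(+ _) N 1≤N =
  inj₁ (ℤP.i≤i+j q k , ℤP.+-monoʳ-≤ q (k≤k*N (ℤP.*-monoˡ-≤-nonNeg k (ℤ.+≤+ 1≤N))))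
  where
  k≤k*N : k ℤ.* 1ℤ ℤ.≤ k ℤ.* + N → k ℤ.≤ k ℤ.* + N
  k≤k*N = subst (ℤ._≤ k ℤ.* + N) (ℤP.*-identityʳ k)
between-+-* q k@(ℤ.-[1+ _ ]) N 1≤N =
  inj₂ (ℤP.+-monoʳ-≤ q (k*N≤k (ℤP.*-monoˡ-≤-nonPos k (ℤ.+≤+ 1≤N))) , q+k≤q)
  where
  q+k≤q : q ℤ.+ k ℤ.≤ q
  q+k≤q = subst (q ℤ.+ k ℤ.≤_) (ℤP.+-identityʳ q) (ℤP.+-monoʳ-≤ q (ℤP.nonPositive⁻¹ k))
  k*N≤k : k ℤ.* + N ℤ.≤ k ℤ.* 1ℤ → k ℤ.* + N ℤ.≤ k
  k*N≤k = subst (k ℤ.* + N ℤ.≤_) (ℤP.*-identityʳ k)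

k≡k*2^[1+n]⇒k≡0 : ∀ k n → k ≡ k ℤ.* + (2 ^ suc n) → k ≡ 0ℤ
k≡k*2^[1+n]⇒k≡0 k n eq with k ℤ.≟ 0ℤ
... | yes k≡0 = k≡0
... | no  k≢0 = contradiction (ℤP.*-cancelˡ-≡ k 1ℤ _ (trans (ℤP.*-identityʳ k) eq)) 1≢2^[1+n]
  where
  instance _ = ℤ.≢-nonZero k≢0
  1≢2^[1+n] : 1ℤ ≢ + (2 ^ suc n)
  1≢2^[1+n] 1≡2^[1+n] with ℕP.m^n≡1⇒n≡0∨m≡1 2 (suc n) (sym (ℤP.+-injective 1≡2^[1+n]))
  ... | inj₁ ()
  ... | inj₂ ()

dilation-fixed-point≡0 : ∀ b₁ b₂ {a₁ a₂ k₁ k₂} → ¬ (b₁ ≡ 0 × b₂ ≡ 0) → ¬ (a₁ ≡ 0ℚ × a₂ ≡ 0ℚ) →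
  OnCurve₀ b₁ b₂ a₁ a₂ 0ℚ 0ℚ → OnCurve₀ b₁ b₂ a₁ a₂ (toℚ k₁) (toℚ k₂) →
  k₁ ≡ k₁ ℤ.* + (2 ^ b₁) → k₂ ≡ k₂ ℤ.* + (2 ^ b₂) → k₁ ≡ 0ℤ × k₂ ≡ 0ℤ
dilation-fixed-point≡0 zero     zero     b≢0 _ _ _ _ _ = contradiction (refl , refl) b≢0
dilation-fixed-point≡0 zero     (suc b₂) {k₁ = k₁} {k₂} _ a≢0 origin on _ fix₂ =
  toℚ-injective (OnCurve₀-axis b₂ (toℚ k₁) (toℚ k₂) a≢0 origin on) , k≡k*2^[1+n]⇒k≡0 k₂ b₂ fix₂
dilation-fixed-point≡0 (suc b₁) zero     {k₁ = k₁} {k₂} _ a≢0 origin on fix₁ _ =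
  k≡k*2^[1+n]⇒k≡0 k₁ b₁ fix₁ ,
  -- `sym` exchanges the roles of the two coordinates in the curve equation.
  toℚ-injective (OnCurve₀-axis b₁ (toℚ k₂) (toℚ k₁) (a≢0 ∘ swap) (sym origin) (sym on))
dilation-fixed-point≡0 (suc b₁) (suc b₂) _ _ _ _ fix₁ fix₂ =
  k≡k*2^[1+n]⇒k≡0 _ b₁ fix₁ , k≡k*2^[1+n]⇒k≡0 _ b₂ fix₂

Visible-dilated⇒offset≡0 : ∀ {b₁ b₂} → ¬ (b₁ ≡ 0 × b₂ ≡ 0) → ∀ q₁ q₂ k₁ k₂ →
  Visible b₁ b₂ (q₁ ℤ.+ k₁ ℤ.* + (2 ^ b₁) , q₂ ℤ.+ k₂ ℤ.* + (2 ^ b₂)) (q₁ , q₂) →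
  k₁ ≡ 0ℤ × k₂ ≡ 0ℤ
Visible-dilated⇒offset≡0 {b₁} {b₂} b≢0 q₁ q₂ k₁ k₂ (a₁ , a₂ , a≢0 , onP , onQ , only-endpoints) =
  [ R≡P⇒k≡0 , R≡Q⇒k≡0 ] (only-endpoints R onR R∈box)
  where
  open Curve b₁ b₂ a₁ a₂ hiding (OnCurve₀)
  R : Point
  R = (q₁ ℤ.+ k₁ , q₂ ℤ.+ k₂)
  two : ℚ
  two = toℚ (+ 2)
  toℚ-*2^ : ∀ k b → toℚ (k ℤ.* + (2 ^ b)) ≡ toℚ k * two ^ℚ b
  toℚ-*2^ k b = trans (toℚ-* k (+ (2 ^ b))) (cong (toℚ k *_) (toℚ-^ 2 b))
  onK : OnCurve₀ b₁ b₂ a₁ a₂ (toℚ k₁) (toℚ k₂)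
  onK = OnCurve₀-dilate⁻¹ two (λ ())
    (subst₂ (OnCurve₀ b₁ b₂ a₁ a₂) (toℚ-*2^ k₁ b₁) (toℚ-*2^ k₂ b₂)
      (Equivalence.to (OnCurve⇔OnCurve₀ q₁ q₂ _ _) onP))
  onR : OnCurve b₁ b₂ a₁ a₂ (q₁ , q₂) R
  onR = Equivalence.from (OnCurve⇔OnCurve₀ q₁ q₂ k₁ k₂) onK
  R∈box : InBox (q₁ ℤ.+ k₁ ℤ.* + (2 ^ b₁) , q₂ ℤ.+ k₂ ℤ.* + (2 ^ b₂)) (q₁ , q₂) R
  R∈box = between-+-* q₁ k₁ _ (ℕP.m^n>0 2 b₁) , between-+-* q₂ k₂ _ (ℕP.m^n>0 2 b₂)
  cancel : ∀ q {k k′} → q ℤ.+ k ≡ q ℤ.+ k′ → k ≡ k′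
  cancel q = ∙-cancelˡ q _ _
  R≡P⇒k≡0 : R ≡ (q₁ ℤ.+ k₁ ℤ.* + (2 ^ b₁) , q₂ ℤ.+ k₂ ℤ.* + (2 ^ b₂)) → k₁ ≡ 0ℤ × k₂ ≡ 0ℤ
  R≡P⇒k≡0 eq = dilation-fixed-point≡0 b₁ b₂ b≢0 a≢0 (OnCurve⇒OnCurve₀-origin q₁ q₂ onQ) onK
    (cancel q₁ (cong proj₁ eq)) (cancel q₂ (cong proj₂ eq))
  R≡Q⇒k≡0 : R ≡ (q₁ , q₂) → k₁ ≡ 0ℤ × k₂ ≡ 0ℤ
  R≡Q⇒k≡0 eq = cancel q₁ (trans (cong proj₁ eq) (sym (ℤP.+-identityʳ q₁)))
             , cancel q₂ (trans (cong proj₂ eq) (sym (ℤP.+-identityʳ q₂)))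

_mod_ : ℤ → (m : ℕ) → .{{NonZero m}} → Fin m
i mod m = fromℕ< (n%ℕd<d i m)

mod-≡⇒≡+* : ∀ i j m .{{_ : NonZero m}} → i mod m ≡ j mod m → ∃[ k ] i ≡ j ℤ.+ k ℤ.* + m
mod-≡⇒≡+* i j m eq = k , (begin
  i                                              ≡⟨ a≡a%ℕn+[a/ℕn]*n i m ⟩
  + (i %ℕ m) ℤ.+ i /ℕ m ℤ.* + m                  ≡⟨ cong (λ r → + r ℤ.+ i /ℕ m ℤ.* + m) i%m≡j%m ⟩
  + (j %ℕ m) ℤ.+ i /ℕ m ℤ.* + m                  ≡⟨ regroup (+ (j %ℕ m)) (i /ℕ m) (j /ℕ m) (+ m) ⟩
  (+ (j %ℕ m) ℤ.+ j /ℕ m ℤ.* + m) ℤ.+ k ℤ.* + m ≡⟨ cong (ℤ._+ k ℤ.* + m) (sym (a≡a%ℕn+[a/ℕn]*n j m)) ⟩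
  j ℤ.+ k ℤ.* + m                                ∎)
  where
  open ≡-Reasoning
  k : ℤ
  k = i /ℕ m ℤ.- j /ℕ m
  i%m≡j%m : i %ℕ m ≡ j %ℕ m
  i%m≡j%m = fromℕ<-injective _ _ (n%ℕd<d i m) (n%ℕd<d j m) eq
  regroup : ∀ r s t d → r ℤ.+ s ℤ.* d ≡ (r ℤ.+ t ℤ.* d) ℤ.+ (s ℤ.- t) ℤ.* d
  regroup = solve-∀

residue : (m₁ m₂ : ℕ) .{{_ : NonZero m₁}} .{{_ : NonZero m₂}} → Point → Fin (m₁ ℕ.* m₂)
residue m₁ m₂ (x , y) = combine (x mod m₁) (y mod m₂)

residue-≡⇒≡+* : ∀ m₁ m₂ .{{_ : NonZero m₁}} .{{_ : NonZero m₂}} p₁ p₂ q₁ q₂ →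
  residue m₁ m₂ (p₁ , p₂) ≡ residue m₁ m₂ (q₁ , q₂) →
  ∃₂ λ k₁ k₂ → (p₁ , p₂) ≡ (q₁ ℤ.+ k₁ ℤ.* + m₁ , q₂ ℤ.+ k₂ ℤ.* + m₂)
residue-≡⇒≡+* m₁ m₂ p₁ p₂ q₁ q₂ eq
  with k₁ , p₁≡ ← mod-≡⇒≡+* p₁ q₁ m₁ (combine-injectiveˡ _ _ (q₁ mod m₁) (q₂ mod m₂) eq)
     | k₂ , p₂≡ ← mod-≡⇒≡+* p₂ q₂ m₂ (combine-injectiveʳ _ _ (q₁ mod m₁) (q₂ mod m₂) eq)
  = k₁ , k₂ , cong₂ _,_ p₁≡ p₂≡

lookup-injective : ∀ {a} {A : Set a} {xs : List A} → Unique xs →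
  ∀ i j → lookup xs i ≡ lookup xs j → i ≡ j
lookup-injective (_     ∷ _)      Fin.zero    Fin.zero    _  = refl
lookup-injective (x∉xs ∷ _)      Fin.zero    (Fin.suc j) eq = contradiction eq (All.lookup x∉xs (∈-lookup j))
lookup-injective (x∉xs ∷ _)      (Fin.suc i) Fin.zero    eq = contradiction (sym eq) (All.lookup x∉xs (∈-lookup i))
lookup-injective (_     ∷ unique) (Fin.suc i) (Fin.suc j) eq = cong Fin.suc (lookup-injective unique i j eq)

module Modulo2^ (b₁ b₂ : ℕ) where

  instance
    2^b₁≢0 : NonZero (2 ^ b₁)
    2^b₁≢0 = ℕP.m^n≢0 2 b₁
    2^b₂≢0 : NonZero (2 ^ b₂)
    2^b₂≢0 = ℕP.m^n≢0 2 b₂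

  visible⇒residue-injective : ¬ (b₁ ≡ 0 × b₂ ≡ 0) → ∀ {P Q} → (P ≢ Q → Visible b₁ b₂ P Q) →
    residue (2 ^ b₁) (2 ^ b₂) P ≡ residue (2 ^ b₁) (2 ^ b₂) Q → P ≡ Q
  visible⇒residue-injective b≢0 {P@(p₁ , p₂)} {Q@(q₁ , q₂)} visible eq with ≡-dec ℤ._≟_ ℤ._≟_ P Q
  ... | yes P≡Q = P≡Q
  ... | no  P≢Q with k₁ , k₂ , refl ← residue-≡⇒≡+* (2 ^ b₁) (2 ^ b₂) p₁ p₂ q₁ q₂ eq
                with refl , refl ← Visible-dilated⇒offset≡0 b≢0 q₁ q₂ k₁ k₂ (visible P≢Q)
                = cong₂ _,_ (ℤP.+-identityʳ q₁) (ℤP.+-identityʳ q₂)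

lemma2p4 : (b₁ b₂ : ℕ) → gcd b₁ b₂ ≡ 1 →
           (W : List Point) → Unique W →
           (∀ {P Q} → P ∈ W → Q ∈ W → P ≢ Q → Visible b₁ b₂ P Q) →
           length W ≤ 2 ^ (b₁ + b₂)
lemma2p4 b₁ b₂ gcd≡1 W unique visible =
  subst (length W ≤_) (sym (ℕP.^-distribˡ-+-* 2 b₁ b₂)) (injective⇒≤ residue∘lookup-injective)
  where
  open Modulo2^ b₁ b₂
  b≢0 : ¬ (b₁ ≡ 0 × b₂ ≡ 0)
  b≢0 (refl , refl) = contradiction gcd≡1 λ ()
  residue∘lookup-injective : Injective _≡_ _≡_ (residue (2 ^ b₁) (2 ^ b₂) ∘ lookup W)
  residue∘lookup-injective {i} {j} =
    lookup-injective unique i j ∘ visible⇒residue-injective b≢0 (visible (∈-lookup i) (∈-lookup j))
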